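{- Let $(G,\sigma)$ be a simple signed corona graph. Then $(G,\sigma)$ is self-invertible.
   Context: The corona of a graph $H$ is the graph obtained from $H$ by adding, for each vertex $v$ of $H$, a new vertex of degree $1$ adjacent only to $v$. A graph is a corona graph if it is the corona of some graph. A signed graph $(G,\sigma)$ is a graph with $\sigma:E(G)\to\{ -1,1\}$, with adjacency matrix $\mathbb A$ given by $(\mathbb A)_{ij}=\sigma(ij)$ if $ij\in E(G)$ and $0$ otherwise; it is simple if $G$ has no loops or multiple edges. If $\mathbb A$ is invertible, the inverse $(G^{ -1},\sigma^{ -1})$ is the weighted graph with adjacency matrix $\mathbb A^{ -1}$ (edges are the pairs with nonzero entries). A weighted graph is self-invertible if it has an inverse $(G^{ -1},\sigma^{ -1})$ whose underlying graph $G^{ -1}$ is isomorphic to $G$ (the weight functions may differ). -}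

module Defs where

open import Data.Nat using (ℕ; zero; suc; _+_)
open import Data.Fin using (Fin; zero; suc; splitAt)
open import Data.Fin.Properties using (_≟_)
open import Data.Bool using (Bool; true; false; if_then_else_)
open import Data.Sum using (_⊎_; inj₁; inj₂)
open import Data.Sign using (Sign)
open import Data.Rational using (ℚ; 0ℚ; 1ℚ; -_) renaming (_+_ to _+ℚ_; _*_ to _*ℚ_)
open import Relation.Nullary using (¬_; does)
open import Relation.Binary.PropositionalEquality using (_≡_)
open import Function.Bundles using (_↔_; _⇔_; Inverse)

record Graph (n : ℕ) : Set where
  field
    adj    : Fin n → Fin n → Bool
    sym    : ∀ i j → adj i j ≡ adj j i
    irrefl : ∀ i → adj i i ≡ false
open Graph public

-- The corona of H (on k vertices): vertices Fin (k + k); the first copy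
-- (inj₁ i) carries H, the second copy (inj₂ i) is the pendant vertex of i.
coronaAdj : ∀ {k} → Graph k → Fin (k + k) → Fin (k + k) → Bool
coronaAdj {k} H x y with splitAt k x | splitAt k y
... | inj₁ i | inj₁ j = adj H i j
... | inj₁ i | inj₂ j = does (i ≟ j)
... | inj₂ i | inj₁ j = does (i ≟ j)
... | inj₂ i | inj₂ j = false

-- A graph G is a corona graph if it is isomorphic to the corona of some graph H.
-- (Stated via an adjacency-preserving bijection to the explicit corona vertex set,
-- so no proof of symmetry of coronaAdj is needed in the definition.)
IsCorona : ∀ {n} → Graph n → Set
IsCorona {n} G =
  Σ' ℕ λ k → Σ' (Graph k) λ H → Σ' (Fin n ↔ Fin (k + k)) λ f →
    ∀ i j → adj G i j ≡ coronaAdj H (Inverse.to f i) (Inverse.to f j)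
  where
    open import Data.Product using () renaming (Σ to Σ')

record SignedGraph (n : ℕ) : Set where
  field
    graph : Graph n
    σ     : Fin n → Fin n → Sign
    σ-sym : ∀ i j → adj graph i j ≡ true → σ i j ≡ σ j i
open SignedGraph public

signℚ : Sign → ℚ
signℚ Sign.+ = 1ℚ
signℚ Sign.- = - 1ℚ

Matrix : ℕ → Set
Matrix n = Fin n → Fin n → ℚ

adjMatrix : ∀ {n} → SignedGraph n → Matrix n
adjMatrix S i j = if adj (graph S) i j then signℚ (σ S i j) else 0ℚ

sumFin : ∀ {n} → (Fin n → ℚ) → ℚ
sumFin {zero}  f = 0ℚ
sumFin {suc n} f = f zero +ℚ sumFin (λ i → f (suc i))

_·_ : ∀ {n} → Matrix n → Matrix n → Matrix n
(A · B) i j = sumFin (λ k → A i k *ℚ B k j)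

identity : ∀ {n} → Matrix n
identity i j = if does (i ≟ j) then 1ℚ else 0ℚ

IsInverse : ∀ {n} → Matrix n → Matrix n → Set
IsInverse {n} A B = (∀ i j → (A · B) i j ≡ identity i j) × (∀ i j → (B · A) i j ≡ identity i j)
  where open import Data.Product using (_×_)

-- The signed graph is self-invertible: its adjacency matrix has an inverse B
-- whose underlying graph (pairs i j with B i j ≠ 0, loops included) is
-- isomorphic to the underlying graph of S.
SelfInvertible : ∀ {n} → SignedGraph n → Set
SelfInvertible {n} S =
  Σ' (Matrix n) λ B → IsInverse (adjMatrix S) B ×
    Σ' (Fin n ↔ Fin n) λ f →
      ∀ i j → (adj (graph S) i j ≡ true) ⇔ (¬ (B (Inverse.to f i) (Inverse.to f j) ≡ 0ℚ))
  where
    open import Data.Product using (_×_) renaming (Σ to Σ')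

module Submission where

-- Relabel the corona so that the vertices of H come first and their pendants second. The signed
-- adjacency matrix then has the block form M = [[P, D], [E, 0]] with P the signed adjacency matrix
-- of H and D, E diagonal with entries ±1 (the signs of the pendant edges). Such an M is inverted by
-- N = [[0, E], [D, −DPE]]. Exchanging the two halves of the vertex set turns N into
-- [[−DPE, D], [E, 0]], which has the zero pattern of M because −DPE is P with rows and columns
-- multiplied by ±1. So the graph of N is the graph of M relabelled by that exchange.

open import Defs hiding (sym)
open import Data.Nat using (ℕ; zero; suc) renaming (_+_ to _+ℕ_)
open import Data.Fin using (Fin; zero; suc; splitAt; _↑ˡ_; _↑ʳ_)
open import Data.Fin.Properties using (_≟_; suc-injective; splitAt-↑ˡ; splitAt-↑ʳ; splitAt-join; +↔⊎)
open import Data.Bool using (Bool; true; false; if_then_else_)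
open import Data.Sum using (_⊎_; inj₁; inj₂; swap)
open import Data.Sum.Properties using (swap-↔)
open import Data.Sign using (Sign)
open import Data.Product using (_,_)
open import Data.Empty using (⊥-elim)
open import Data.Rational using (ℚ; 0ℚ; 1ℚ; -_; _+_; _*_)
open import Data.Rational.Properties
  using (+-identityˡ; +-identityʳ; +-assoc; +-inverseʳ; *-assoc; *-identityˡ; *-identityʳ;
         *-zeroˡ; *-zeroʳ; neg-distribˡ-*; neg-distribʳ-*; neg-injective; +-0-commutativeMonoid)
open import Function.Base using (_∘_; id)
open import Function.Bundles using (_↔_; _⇔_; Inverse; Injection; Equivalence; mk⇔)
open import Function.Properties.Inverse using (↔-trans; ↔-sym; ↔⇒↣)
open import Function.Construct.Composition using (_⇔-∘_)
open import Function.Construct.Symmetry using (⇔-sym)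
open import Relation.Nullary using (¬_; does; yes; no)
open import Relation.Nullary.Decidable using (dec-true; dec-false)
open import Relation.Binary.PropositionalEquality
import Algebra.Properties.CommutativeMonoid.Sum as MonoidSum

open Inverse using (to; from; strictlyInverseˡ; strictlyInverseʳ)

sumFin-cong : ∀ {m} {g h : Fin m → ℚ} → (∀ i → g i ≡ h i) → sumFin g ≡ sumFin h
sumFin-cong {zero}  g≗h = refl
sumFin-cong {suc m} g≗h = cong₂ _+_ (g≗h zero) (sumFin-cong (g≗h ∘ suc))

sumFin-zero : ∀ {m} {g : Fin m → ℚ} → (∀ i → g i ≡ 0ℚ) → sumFin g ≡ 0ℚ
sumFin-zero {zero}  g≗0 = refl
sumFin-zero {suc m} g≗0 = cong₂ _+_ (g≗0 zero) (sumFin-zero (g≗0 ∘ suc))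

sumFin-single : ∀ {m} (i : Fin m) {g : Fin m → ℚ} → (∀ l → l ≢ i → g l ≡ 0ℚ) → sumFin g ≡ g i
sumFin-single zero {g} g≗0 =
  trans (cong (g zero +_) (sumFin-zero λ l → g≗0 (suc l) λ ())) (+-identityʳ (g zero))
sumFin-single (suc i) {g} g≗0 =
  trans (cong₂ _+_ (g≗0 zero λ ()) (sumFin-single i λ l l≢i → g≗0 (suc l) (l≢i ∘ suc-injective)))
        (+-identityˡ (g (suc i)))

sumFin-++ : ∀ a {b} (g : Fin (a +ℕ b) → ℚ) →
  sumFin g ≡ sumFin (λ i → g (i ↑ˡ b)) + sumFin (λ i → g (a ↑ʳ i))
sumFin-++ zero    g = sym (+-identityˡ (sumFin g))
sumFin-++ (suc a) g =
  trans (cong (g zero +_) (sumFin-++ a (g ∘ suc))) (sym (+-assoc (g zero) _ _))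

sumFin-reindex : ∀ {m n} (π : Fin m ↔ Fin n) (g : Fin n → ℚ) → sumFin (g ∘ to π) ≡ sumFin g
sumFin-reindex π g = begin
  sumFin (g ∘ to π) ≡⟨ sumFin≡sum (g ∘ to π) ⟩
  sum (g ∘ to π)    ≡⟨ sym (∑-permute g π) ⟩
  sum g             ≡⟨ sym (sumFin≡sum g) ⟩
  sumFin g          ∎
  where
  open ≡-Reasoning
  open MonoidSum +-0-commutativeMonoid using (sum; ∑-permute)

  sumFin≡sum : ∀ {m} (h : Fin m → ℚ) → sumFin h ≡ sum h
  sumFin≡sum {zero}  h = refl
  sumFin≡sum {suc m} h = cong (h zero +_) (sumFin≡sum (h ∘ suc))

infix  4 _≈_
infixl 6 _+ᴹ_
infix  8 -ᴹ_

_≈_ : ∀ {n} → Matrix n → Matrix n → Set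
A ≈ B = ∀ i j → A i j ≡ B i j

0ᴹ : ∀ {n} → Matrix n
0ᴹ _ _ = 0ℚ

_+ᴹ_ : ∀ {n} → Matrix n → Matrix n → Matrix n
(A +ᴹ B) i j = A i j + B i j

-ᴹ_ : ∀ {n} → Matrix n → Matrix n
(-ᴹ A) i j = - A i j

diag : ∀ {n} → (Fin n → ℚ) → Matrix n
diag d i j = if does (i ≟ j) then d i else 0ℚ

reindex : ∀ {m n} → Fin m ↔ Fin n → Matrix n → Matrix m
reindex π A i j = A (to π i) (to π j)

·-congʳ : ∀ {n} {A A′ : Matrix n} (B : Matrix n) → A ≈ A′ → A · B ≈ A′ · B
·-congʳ B A≈A′ i j = sumFin-cong λ l → cong (_* B l j) (A≈A′ i l)

·-congˡ : ∀ {n} {B B′ : Matrix n} (A : Matrix n) → B ≈ B′ → A · B ≈ A · B′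
·-congˡ A B≈B′ i j = sumFin-cong λ l → cong (A i l *_) (B≈B′ l j)

·-zeroˡ : ∀ {n} (A : Matrix n) → 0ᴹ · A ≈ 0ᴹ
·-zeroˡ A i j = sumFin-zero λ l → *-zeroˡ (A l j)

·-zeroʳ : ∀ {n} (A : Matrix n) → A · 0ᴹ ≈ 0ᴹ
·-zeroʳ A i j = sumFin-zero λ l → *-zeroʳ (A i l)

diag-diagonal : ∀ {n} (d : Fin n → ℚ) i → diag d i i ≡ d i
diag-diagonal d i rewrite dec-true (i ≟ i) refl = refl

diag-offDiagonal : ∀ {n} (d : Fin n → ℚ) {i j} → i ≢ j → diag d i j ≡ 0ℚ
diag-offDiagonal d {i} {j} i≢j rewrite dec-false (i ≟ j) i≢j = refl

diag-· : ∀ {n} (d : Fin n → ℚ) (A : Matrix n) i j → (diag d · A) i j ≡ d i * A i j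
diag-· d A i j =
  trans (sumFin-single i λ l l≢i →
           trans (cong (_* A l j) (diag-offDiagonal d (l≢i ∘ sym))) (*-zeroˡ (A l j)))
        (cong (_* A i j) (diag-diagonal d i))

·-diag : ∀ {n} (A : Matrix n) (d : Fin n → ℚ) i j → (A · diag d) i j ≡ A i j * d j
·-diag A d i j =
  trans (sumFin-single j λ l l≢j →
           trans (cong (A i l *_) (diag-offDiagonal d l≢j)) (*-zeroʳ (A i l)))
        (cong (A i j *_) (diag-diagonal d j))

diag-square : ∀ {n} (d : Fin n → ℚ) → (∀ i → d i * d i ≡ 1ℚ) → diag d · diag d ≈ identity
diag-square d d²≡1 i j with i ≟ j
... | yes refl = trans (diag-· d (diag d) i i) (trans (cong (d i *_) (diag-diagonal d i)) (d²≡1 i))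
... | no i≢j   = trans (diag-· d (diag d) i j) (trans (cong (d i *_) (diag-offDiagonal d i≢j)) (*-zeroʳ (d i)))

reindex-· : ∀ {m n} (π : Fin m ↔ Fin n) (A B : Matrix n) →
  reindex π A · reindex π B ≈ reindex π (A · B)
reindex-· π A B i j = sumFin-reindex π (λ l → A (to π i) l * B l (to π j))

reindex-identity : ∀ {m n} (π : Fin m ↔ Fin n) → reindex π identity ≈ identity
reindex-identity π i j with i ≟ j
... | yes refl = diag-diagonal (λ _ → 1ℚ) (to π i)
... | no i≢j   = diag-offDiagonal (λ _ → 1ℚ) (i≢j ∘ Injection.injective (↔⇒↣ π))

IsInverse-reindex : ∀ {m n} (π : Fin m ↔ Fin n) (A B : Matrix n) →
  IsInverse A B → IsInverse (reindex π A) (reindex π B)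
IsInverse-reindex π A B (AB≈I , BA≈I) =
  (λ i j → trans (reindex-· π A B i j) (trans (AB≈I _ _) (reindex-identity π i j))) ,
  (λ i j → trans (reindex-· π B A i j) (trans (BA≈I _ _) (reindex-identity π i j)))

IsInverse-congˡ : ∀ {n} {A A′ : Matrix n} (B : Matrix n) → A ≈ A′ → IsInverse A′ B → IsInverse A B
IsInverse-congˡ B A≈A′ (A′B≈I , BA′≈I) =
  (λ i j → trans (·-congʳ B A≈A′ i j) (A′B≈I i j)) ,
  (λ i j → trans (·-congˡ B A≈A′ i j) (BA′≈I i j))

blockAt : ∀ {k} (P Q R T : Matrix k) → Fin k ⊎ Fin k → Fin k ⊎ Fin k → ℚ
blockAt P Q R T (inj₁ i) (inj₁ j) = P i j
blockAt P Q R T (inj₁ i) (inj₂ j) = Q i j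
blockAt P Q R T (inj₂ i) (inj₁ j) = R i j
blockAt P Q R T (inj₂ i) (inj₂ j) = T i j

-- [[P, Q], [R, T]]; splitAt sends the first k indices to the first block.
block : ∀ {k} (P Q R T : Matrix k) → Matrix (k +ℕ k)
block {k} P Q R T x y = blockAt P Q R T (splitAt k x) (splitAt k y)

block-cong : ∀ {k} {P P′ Q Q′ R R′ T T′ : Matrix k} →
  P ≈ P′ → Q ≈ Q′ → R ≈ R′ → T ≈ T′ → block P Q R T ≈ block P′ Q′ R′ T′
block-cong {k} P≈ Q≈ R≈ T≈ x y with splitAt k x | splitAt k y
... | inj₁ i | inj₁ j = P≈ i j
... | inj₁ i | inj₂ j = Q≈ i j
... | inj₂ i | inj₁ j = R≈ i j
... | inj₂ i | inj₂ j = T≈ i j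

block-· : ∀ {k} (P Q R T P′ Q′ R′ T′ : Matrix k) →
  block P Q R T · block P′ Q′ R′ T′ ≈
  block (P · P′ +ᴹ Q · R′) (P · Q′ +ᴹ Q · T′) (R · P′ +ᴹ T · R′) (R · Q′ +ᴹ T · T′)
block-· {k} P Q R T P′ Q′ R′ T′ x y =
  trans (sumFin-++ k _)
    (trans (cong₂ _+_ (sumFin-cong λ l → cong term (splitAt-↑ˡ k l k))
                      (sumFin-cong λ l → cong term (splitAt-↑ʳ k k l)))
           (multiply (splitAt k x) (splitAt k y)))
  where
  term : Fin k ⊎ Fin k → ℚ
  term p = blockAt P Q R T (splitAt k x) p * blockAt P′ Q′ R′ T′ p (splitAt k y)

  multiply : ∀ p q →
    sumFin (λ l → blockAt P Q R T p (inj₁ l) * blockAt P′ Q′ R′ T′ (inj₁ l) q) +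
    sumFin (λ l → blockAt P Q R T p (inj₂ l) * blockAt P′ Q′ R′ T′ (inj₂ l) q) ≡
    blockAt (P · P′ +ᴹ Q · R′) (P · Q′ +ᴹ Q · T′) (R · P′ +ᴹ T · R′) (R · Q′ +ᴹ T · T′) p q
  multiply (inj₁ i) (inj₁ j) = refl
  multiply (inj₁ i) (inj₂ j) = refl
  multiply (inj₂ i) (inj₁ j) = refl
  multiply (inj₂ i) (inj₂ j) = refl

identity-block : ∀ {k} → identity ≈ block {k} identity 0ᴹ 0ᴹ identity
identity-block {k} x y with x ≟ y
... | yes refl = sym (onDiagonal (splitAt k x))
  where
  onDiagonal : ∀ p → blockAt identity 0ᴹ 0ᴹ identity p p ≡ 1ℚ
  onDiagonal (inj₁ i) = diag-diagonal (λ _ → 1ℚ) i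
  onDiagonal (inj₂ i) = diag-diagonal (λ _ → 1ℚ) i
... | no x≢y = sym (offDiagonal (splitAt k x) (splitAt k y) (x≢y ∘ Injection.injective (↔⇒↣ +↔⊎)))
  where
  offDiagonal : ∀ p q → p ≢ q → blockAt identity 0ᴹ 0ᴹ identity p q ≡ 0ℚ
  offDiagonal (inj₁ i) (inj₁ j) p≢q = diag-offDiagonal (λ _ → 1ℚ) (p≢q ∘ cong inj₁)
  offDiagonal (inj₁ i) (inj₂ j) p≢q = refl
  offDiagonal (inj₂ i) (inj₁ j) p≢q = refl
  offDiagonal (inj₂ i) (inj₂ j) p≢q = diag-offDiagonal (λ _ → 1ℚ) (p≢q ∘ cong inj₂)

swapHalves : ∀ k → Fin (k +ℕ k) ↔ Fin (k +ℕ k)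
swapHalves k = ↔-trans (+↔⊎ {k} {k}) (↔-trans swap-↔ (↔-sym (+↔⊎ {k} {k})))

block-swapHalves : ∀ {k} (P Q R T : Matrix k) x y →
  block P Q R T (to (swapHalves k) x) (to (swapHalves k) y) ≡ block T R Q P x y
block-swapHalves {k} P Q R T x y =
  trans (cong₂ (blockAt P Q R T) (splitAt-join k k (swap (splitAt k x))) (splitAt-join k k (swap (splitAt k y))))
        (swapped (splitAt k x) (splitAt k y))
  where
  swapped : ∀ p q → blockAt P Q R T (swap p) (swap q) ≡ blockAt T R Q P p q
  swapped (inj₁ i) (inj₁ j) = refl
  swapped (inj₁ i) (inj₂ j) = refl
  swapped (inj₂ i) (inj₁ j) = refl
  swapped (inj₂ i) (inj₂ j) = refl

block-≡0-congˡ : ∀ {k} {P P′ : Matrix k} (Q R T : Matrix k) →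
  (∀ i j → P i j ≡ 0ℚ ⇔ P′ i j ≡ 0ℚ) →
  ∀ x y → block P Q R T x y ≡ 0ℚ ⇔ block P′ Q R T x y ≡ 0ℚ
block-≡0-congˡ {k} Q R T P≡0⇔P′≡0 x y with splitAt k x | splitAt k y
... | inj₁ i | inj₁ j = P≡0⇔P′≡0 i j
... | inj₁ i | inj₂ j = mk⇔ id id
... | inj₂ i | inj₁ j = mk⇔ id id
... | inj₂ i | inj₂ j = mk⇔ id id

module _ (u : ℚ) (u²≡1 : u * u ≡ 1ℚ) where

  *-selfInverseˡ : ∀ x → u * (u * x) ≡ x
  *-selfInverseˡ x = trans (sym (*-assoc u u x)) (trans (cong (_* x) u²≡1) (*-identityˡ x))

  *-selfInverseʳ : ∀ x → x * u * u ≡ x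
  *-selfInverseʳ x = trans (*-assoc x u u) (trans (cong (x *_) u²≡1) (*-identityʳ x))

  +-neg-selfInverseˡ : ∀ x → x + u * - (u * x) ≡ 0ℚ
  +-neg-selfInverseˡ x =
    trans (cong (x +_) (trans (sym (neg-distribʳ-* u (u * x))) (cong -_ (*-selfInverseˡ x))))
          (+-inverseʳ x)

  +-neg-selfInverseʳ : ∀ x → x + - (x * u) * u ≡ 0ℚ
  +-neg-selfInverseʳ x =
    trans (cong (x +_) (trans (sym (neg-distribˡ-* (x * u) u)) (cong -_ (*-selfInverseʳ x))))
          (+-inverseʳ x)

neg-selfInverse-scale-≡0 : ∀ (u v : ℚ) → u * u ≡ 1ℚ → v * v ≡ 1ℚ →
  ∀ x → - (u * (x * v)) ≡ 0ℚ ⇔ x ≡ 0ℚ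
neg-selfInverse-scale-≡0 u v u²≡1 v²≡1 x = mk⇔ unscale scale
  where
  unscale : - (u * (x * v)) ≡ 0ℚ → x ≡ 0ℚ
  unscale scaled≡0 = begin
    x                       ≡⟨ sym (*-selfInverseʳ v v²≡1 x) ⟩
    x * v * v               ≡⟨ cong (_* v) (sym (*-selfInverseˡ u u²≡1 (x * v))) ⟩
    u * (u * (x * v)) * v   ≡⟨ cong (λ y → u * y * v) (neg-injective scaled≡0) ⟩
    u * 0ℚ * v              ≡⟨ cong (_* v) (*-zeroʳ u) ⟩
    0ℚ * v                  ≡⟨ *-zeroˡ v ⟩
    0ℚ                      ∎
    where open ≡-Reasoning

  scale : x ≡ 0ℚ → - (u * (x * v)) ≡ 0ℚ
  scale refl = cong -_ (trans (cong (u *_) (*-zeroˡ v)) (*-zeroʳ u))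

coronaBlock : ∀ {k} → Matrix k → (d e : Fin k → ℚ) → Matrix (k +ℕ k)
coronaBlock P d e = block P (diag d) (diag e) 0ᴹ

-- [[P, D], [E, 0]]⁻¹ = [[0, E⁻¹], [D⁻¹, −D⁻¹ P E⁻¹]], with D⁻¹ = D and E⁻¹ = E when d² = e² = 1.
coronaBlock⁻¹ : ∀ {k} → Matrix k → (d e : Fin k → ℚ) → Matrix (k +ℕ k)
coronaBlock⁻¹ P d e = block 0ᴹ (diag e) (diag d) (-ᴹ ((diag d · P) · diag e))

diag-·-diag : ∀ {k} (P : Matrix k) (d e : Fin k → ℚ) i j →
  ((diag d · P) · diag e) i j ≡ d i * (P i j * e j)
diag-·-diag P d e i j =
  trans (·-diag (diag d · P) e i j) (trans (cong (_* e j) (diag-· d P i j)) (*-assoc (d i) (P i j) (e j)))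

module _ {k} (P : Matrix k) (d e : Fin k → ℚ)
         (d²≡1 : ∀ i → d i * d i ≡ 1ℚ) (e²≡1 : ∀ i → e i * e i ≡ 1ℚ) where

  private
    N : Matrix k
    N = -ᴹ ((diag d · P) · diag e)

  coronaBlock-·-coronaBlock⁻¹ : coronaBlock P d e · coronaBlock⁻¹ P d e ≈ identity
  coronaBlock-·-coronaBlock⁻¹ x y =
    trans (block-· P (diag d) (diag e) 0ᴹ 0ᴹ (diag e) (diag d) N x y)
          (trans (block-cong topLeft topRight bottomLeft bottomRight x y) (sym (identity-block {k} x y)))
    where
    topLeft : P · 0ᴹ +ᴹ diag d · diag d ≈ identity
    topLeft i j = trans (cong₂ _+_ (·-zeroʳ P i j) (diag-square d d²≡1 i j)) (+-identityˡ _)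

    topRight : P · diag e +ᴹ diag d · N ≈ 0ᴹ
    topRight i j =
      trans (cong₂ _+_ (·-diag P e i j)
                       (trans (diag-· d N i j) (cong (λ y → d i * - y) (diag-·-diag P d e i j))))
            (+-neg-selfInverseˡ (d i) (d²≡1 i) (P i j * e j))

    bottomLeft : diag e · 0ᴹ +ᴹ 0ᴹ · diag d ≈ 0ᴹ
    bottomLeft i j = cong₂ _+_ (·-zeroʳ (diag e) i j) (·-zeroˡ (diag d) i j)

    bottomRight : diag e · diag e +ᴹ 0ᴹ · N ≈ identity
    bottomRight i j = trans (cong₂ _+_ (diag-square e e²≡1 i j) (·-zeroˡ N i j)) (+-identityʳ _)

  coronaBlock⁻¹-·-coronaBlock : coronaBlock⁻¹ P d e · coronaBlock P d e ≈ identity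
  coronaBlock⁻¹-·-coronaBlock x y =
    trans (block-· 0ᴹ (diag e) (diag d) N P (diag d) (diag e) 0ᴹ x y)
          (trans (block-cong topLeft topRight bottomLeft bottomRight x y) (sym (identity-block {k} x y)))
    where
    topLeft : 0ᴹ · P +ᴹ diag e · diag e ≈ identity
    topLeft i j = trans (cong₂ _+_ (·-zeroˡ P i j) (diag-square e e²≡1 i j)) (+-identityˡ _)

    topRight : 0ᴹ · diag d +ᴹ diag e · 0ᴹ ≈ 0ᴹ
    topRight i j = cong₂ _+_ (·-zeroˡ (diag d) i j) (·-zeroʳ (diag e) i j)

    bottomLeft : diag d · P +ᴹ N · diag e ≈ 0ᴹ
    bottomLeft i j =
      trans (cong₂ _+_ (diag-· d P i j)
                       (trans (·-diag N e i j)
                              (cong (λ y → - y * e j)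
                                    (trans (diag-·-diag P d e i j) (sym (*-assoc (d i) (P i j) (e j)))))))
            (+-neg-selfInverseʳ (e j) (e²≡1 j) (d i * P i j))

    bottomRight : diag d · diag d +ᴹ N · 0ᴹ ≈ identity
    bottomRight i j = trans (cong₂ _+_ (diag-square d d²≡1 i j) (·-zeroʳ N i j)) (+-identityʳ _)

  coronaBlock-inverse : IsInverse (coronaBlock P d e) (coronaBlock⁻¹ P d e)
  coronaBlock-inverse = coronaBlock-·-coronaBlock⁻¹ , coronaBlock⁻¹-·-coronaBlock

  coronaBlock⁻¹-swapHalves-≡0 : ∀ x y →
    coronaBlock⁻¹ P d e (to (swapHalves k) x) (to (swapHalves k) y) ≡ 0ℚ ⇔ coronaBlock P d e x y ≡ 0ℚ
  coronaBlock⁻¹-swapHalves-≡0 x y =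
    subst (λ z → z ≡ 0ℚ ⇔ coronaBlock P d e x y ≡ 0ℚ) (sym (block-swapHalves 0ᴹ (diag e) (diag d) N x y))
      (block-≡0-congˡ (diag d) (diag e) 0ᴹ N≡0⇔P≡0 x y)
    where
    N≡0⇔P≡0 : ∀ i j → N i j ≡ 0ℚ ⇔ P i j ≡ 0ℚ
    N≡0⇔P≡0 i j =
      subst (λ z → - z ≡ 0ℚ ⇔ P i j ≡ 0ℚ) (sym (diag-·-diag P d e i j))
        (neg-selfInverse-scale-≡0 (d i) (e j) (d²≡1 i) (e²≡1 j) (P i j))

¬-⇔ : ∀ {a b} {A : Set a} {B : Set b} → A ⇔ B → (¬ A) ⇔ (¬ B)
¬-⇔ A⇔B = mk⇔ (λ ¬a b → ¬a (Equivalence.from A⇔B b)) (λ ¬b a → ¬b (Equivalence.to A⇔B a))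

signℚ² : ∀ s → signℚ s * signℚ s ≡ 1ℚ
signℚ² Sign.+ = refl
signℚ² Sign.- = refl

signℚ≢0 : ∀ s → signℚ s ≢ 0ℚ
signℚ≢0 Sign.+ ()
signℚ≢0 Sign.- ()

adjMatrix-≢0 : ∀ {n} (S : SignedGraph n) i j → adj (graph S) i j ≡ true ⇔ (¬ adjMatrix S i j ≡ 0ℚ)
adjMatrix-≢0 S i j with adj (graph S) i j
... | true  = mk⇔ (λ _ → signℚ≢0 (σ S i j)) (λ _ → refl)
... | false = mk⇔ (λ ()) (λ ≢0 → ⊥-elim (≢0 refl))

coronaAt : ∀ {k} → Graph k → Fin k ⊎ Fin k → Fin k ⊎ Fin k → Bool
coronaAt H (inj₁ i) (inj₁ j) = adj H i j
coronaAt H (inj₁ i) (inj₂ j) = does (i ≟ j)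
coronaAt H (inj₂ i) (inj₁ j) = does (i ≟ j)
coronaAt H (inj₂ i) (inj₂ j) = false

coronaAdj-splitAt : ∀ {k} (H : Graph k) x y → coronaAdj H x y ≡ coronaAt H (splitAt k x) (splitAt k y)
coronaAdj-splitAt {k} H x y with splitAt k x | splitAt k y
... | inj₁ i | inj₁ j = refl
... | inj₁ i | inj₂ j = refl
... | inj₂ i | inj₁ j = refl
... | inj₂ i | inj₂ j = refl

module Corona {n k} (S : SignedGraph n) (H : Graph k) (f : Fin n ↔ Fin (k +ℕ k))
       (isCorona : ∀ i j → adj (graph S) i j ≡ coronaAdj H (to f i) (to f j)) where

  private
    τ : Fin n ↔ (Fin k ⊎ Fin k)
    τ = ↔-trans f (+↔⊎ {k} {k})

    edgeSign : Fin k ⊎ Fin k → Fin k ⊎ Fin k → Sign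
    edgeSign p q = σ S (from τ p) (from τ q)

    sign : Fin k ⊎ Fin k → Fin k ⊎ Fin k → ℚ
    sign p q = signℚ (edgeSign p q)

  baseMatrix : Matrix k
  baseMatrix i j = if adj H i j then sign (inj₁ i) (inj₁ j) else 0ℚ

  -- σ need not be symmetric here, so the two signs of a pendant edge are kept apart.
  outSign inSign : Fin k → ℚ
  outSign i = sign (inj₁ i) (inj₂ i)
  inSign  i = sign (inj₂ i) (inj₁ i)

  outSign² : ∀ i → outSign i * outSign i ≡ 1ℚ
  outSign² i = signℚ² (edgeSign (inj₁ i) (inj₂ i))

  inSign² : ∀ i → inSign i * inSign i ≡ 1ℚ
  inSign² i = signℚ² (edgeSign (inj₂ i) (inj₁ i))

  adjMatrix-coronaBlock : adjMatrix S ≈ reindex f (coronaBlock baseMatrix outSign inSign)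
  adjMatrix-coronaBlock i j =
    trans (cong₂ (adjMatrix S) (sym (strictlyInverseʳ τ i)) (sym (strictlyInverseʳ τ j)))
          (adjMatrix-from (to τ i) (to τ j))
    where
    adj-from : ∀ p q → adj (graph S) (from τ p) (from τ q) ≡ coronaAt H p q
    adj-from p q =
      trans (isCorona (from τ p) (from τ q))
            (trans (coronaAdj-splitAt H (to f (from τ p)) (to f (from τ q)))
                   (cong₂ (coronaAt H) (strictlyInverseˡ τ p) (strictlyInverseˡ τ q)))

    entry : ∀ p q → (if coronaAt H p q then sign p q else 0ℚ) ≡
                    blockAt baseMatrix (diag outSign) (diag inSign) 0ᴹ p q
    entry (inj₁ i) (inj₁ j) = refl
    entry (inj₁ i) (inj₂ j) with i ≟ j
    ... | yes refl = refl
    ... | no _     = refl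
    entry (inj₂ i) (inj₁ j) with i ≟ j
    ... | yes refl = refl
    ... | no _     = refl
    entry (inj₂ i) (inj₂ j) = refl

    adjMatrix-from : ∀ p q → adjMatrix S (from τ p) (from τ q) ≡
                             blockAt baseMatrix (diag outSign) (diag inSign) 0ᴹ p q
    adjMatrix-from p q =
      trans (cong (λ b → if b then sign p q else 0ℚ) (adj-from p q)) (entry p q)

theorem3p6 : ∀ {n : ℕ} (S : SignedGraph n) → IsCorona (graph S) → SelfInvertible S
theorem3p6 {n} S (k , H , f , isCorona) =
  B , IsInverse-congˡ B adjMatrix-coronaBlock (IsInverse-reindex f M M⁻¹ M-inverse) ,
  relabel , λ i j → ¬-⇔ (⇔-sym (zeroPattern i j)) ⇔-∘ adjMatrix-≢0 S i j
  where
  open Corona S H f isCorona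

  M M⁻¹ : Matrix (k +ℕ k)
  M   = coronaBlock baseMatrix outSign inSign
  M⁻¹ = coronaBlock⁻¹ baseMatrix outSign inSign

  M-inverse : IsInverse M M⁻¹
  M-inverse = coronaBlock-inverse baseMatrix outSign inSign outSign² inSign²

  B : Matrix n
  B = reindex f M⁻¹

  relabel : Fin n ↔ Fin n
  relabel = ↔-trans f (↔-trans (swapHalves k) (↔-sym f))

  zeroPattern : ∀ i j → B (to relabel i) (to relabel j) ≡ 0ℚ ⇔ adjMatrix S i j ≡ 0ℚ
  zeroPattern i j =
    subst₂ (λ a b → a ≡ 0ℚ ⇔ b ≡ 0ℚ)
      (cong₂ M⁻¹ (sym (strictlyInverseˡ f _)) (sym (strictlyInverseˡ f _)))
      (sym (adjMatrix-coronaBlock i j))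
      (coronaBlock⁻¹-swapHalves-≡0 baseMatrix outSign inSign outSign² inSign² (to f i) (to f j))
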